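{- For $m\ge 1$ let $G_m=P_{4m}\times P_{3m}$. Then $\dim_{1,f}(G_m)=\Theta(m^2)$, i.e., there exist positive constants $c_1,c_2$ such that $c_1m^2\le \dim_{1,f}(G_m)\le c_2 m^2$ for all sufficiently large $m$.
   Context: $P_s\times P_t$ denotes the grid graph, the Cartesian product of the paths $P_s$ and $P_t$ (on $s$ and $t$ vertices). $d(x,y)$ denotes the distance in a graph $G$. Let $d_1(x,y)=\min\{d(x,y),2\}$ and, for distinct $x,y\in V(G)$, $R_1\{x,y\}=\{z\in V(G): d_1(x,z)\neq d_1(y,z)\}$. For $g$ defined on $V(G)$ and $U\subseteq V(G)$, $g(U)=\sum_{s\in U}g(s)$. A function $h:V(G)\to[0,1]$ is a $1$-truncated resolving function if $h(R_1\{x,y\})\ge 1$ for all distinct $x,y$; $\dim_{1,f}(G)$ is the minimum of $h(V(G))$ over such $h$.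
   Formalization: The 1-truncated resolving functions h take only rational values in [0,1], and the constants c₁ and c₂ are rational. -}

module Defs where

open import Data.Nat as ℕ using (ℕ; suc)
open import Data.Fin using (Fin; toℕ)
open import Data.Fin.Properties using () renaming (_≟_ to _≟ᶠ_)
open import Data.Bool using (Bool; true; false; if_then_else_; _∧_; _∨_; not)
open import Data.Product using (_×_; _,_; proj₁; proj₂)
open import Data.List using (List; foldr; map; allFin; cartesianProduct)
open import Data.Rational using (ℚ; 0ℚ; 1ℚ; _+_; _≤_)
open import Relation.Nullary.Decidable using (⌊_⌋)
open import Relation.Binary.PropositionalEquality using (_≢_)

Vertex : ℕ → ℕ → Set
Vertex s t = Fin s × Fin t

adjPath : ∀ {n} → Fin n → Fin n → Bool
adjPath i j = ⌊ suc (toℕ i) ℕ.≟ toℕ j ⌋ ∨ ⌊ suc (toℕ j) ℕ.≟ toℕ i ⌋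

eqFin : ∀ {n} → Fin n → Fin n → Bool
eqFin i j = ⌊ i ≟ᶠ j ⌋

adjGrid : ∀ {s t} → Vertex s t → Vertex s t → Bool
adjGrid (i , j) (i' , j') =
  (eqFin i i' ∧ adjPath j j') ∨ (adjPath i i' ∧ eqFin j j')

eqV : ∀ {s t} → Vertex s t → Vertex s t → Bool
eqV (i , j) (i' , j') = eqFin i i' ∧ eqFin j j'

-- d₁(x,y) = min{d(x,y),2} : 0 if x = y, 1 if adjacent, 2 otherwise
d₁ : ∀ {s t} → Vertex s t → Vertex s t → ℕ
d₁ x y = if eqV x y then 0 else (if adjGrid x y then 1 else 2)

inR₁ : ∀ {s t} → Vertex s t → Vertex s t → Vertex s t → Bool
inR₁ x y z = not ⌊ d₁ x z ℕ.≟ d₁ y z ⌋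

vertices : (s t : ℕ) → List (Vertex s t)
vertices s t = cartesianProduct (allFin s) (allFin t)

sumℚ : List ℚ → ℚ
sumℚ = foldr _+_ 0ℚ

total : ∀ {s t} → (Vertex s t → ℚ) → ℚ
total {s} {t} h = sumℚ (map h (vertices s t))

weightR₁ : ∀ {s t} → (Vertex s t → ℚ) → Vertex s t → Vertex s t → ℚ
weightR₁ {s} {t} h x y =
  sumℚ (map (λ z → if inR₁ x y z then h z else 0ℚ) (vertices s t))

Is1TruncResolving : ∀ {s t} → (Vertex s t → ℚ) → Set
Is1TruncResolving {s} {t} h =
  (∀ (v : Vertex s t) → (0ℚ ≤ h v) × (h v ≤ 1ℚ)) ×
  (∀ (x y : Vertex s t) → x ≢ y → 1ℚ ≤ weightR₁ h x y)

{-# OPTIONS --safe #-}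
-- Cut P₄ₘ × P₃ₘ into m² blocks of 4 × 3 vertices. In the block with corner (4k, 3l) take
-- x = (4k+1, 3l+1) and y = (4k+2, 3l+1): a vertex distinguishing them is within distance 1
-- of x or y, hence lies in the same block. So the sets R₁{x, y} of different blocks are
-- disjoint, and summing h(R₁{x, y}) ≥ 1 over the blocks gives h(V) ≥ m². Conversely the
-- constant function 1 resolves every pair, as x ∈ R₁{x, y}, and has weight 12m².
module Submission where

open import Defs
open import Data.Nat using (ℕ; suc; _≤_; _*_; _+_; z≤n; s≤s)
import Data.Nat as ℕ
import Data.Nat.Properties as ℕ
open import Data.Nat.Solver using (module +-*-Solver)
open import Data.Fin using (Fin; toℕ; combine; cast)
open import Data.Fin.Patterns using (1F; 2F)
open import Data.Fin.Properties using (toℕ-combine; toℕ-cast; toℕ-injective) renaming (_≟_ to _≟ᶠ_)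
open import Data.Bool using (Bool; true; false; T; if_then_else_)
open import Data.Bool.Properties using (T-∧; T-∨)
open import Data.Unit using (tt)
open import Data.Empty using (⊥-elim)
open import Data.Product using (Σ; _×_; _,_; proj₁; proj₂)
open import Data.Sum using (_⊎_; inj₁; inj₂)
open import Data.List using (List; []; _∷_; map; length; allFin; cartesianProduct)
open import Data.List.Properties using (length-++; length-map; length-tabulate)
open import Data.List.Membership.Propositional using (_∈_)
open import Data.List.Membership.Propositional.Properties using (∈-cartesianProduct⁺; ∈-allFin)
open import Data.List.Relation.Unary.All using (All; []; _∷_)
import Data.List.Relation.Unary.All as All
open import Data.List.Relation.Unary.Any using (here; there)
open import Data.List.Relation.Unary.Unique.Propositional using (Unique; []; _∷_)
open import Data.List.Relation.Unary.Unique.Propositional.Properties using (allFin⁺)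
  renaming (cartesianProduct⁺ to unique-cartesianProduct⁺)
open import Data.Rational using (ℚ; _<_; 0ℚ; 1ℚ; _/_) renaming (_≤_ to _≤ℚ_; _*_ to _*ℚ_; _+_ to _+ℚ_)
import Data.Rational.Properties as ℚ
open import Data.Integer using (+_)
import Data.Integer as ℤ
import Data.Integer.Properties as ℤ
open import Data.Nat.Coprimality using (1-coprimeTo)
import Data.Nat.Coprimality as Coprime
open import Algebra.Bundles using (CommutativeMonoid)
open import Algebra.Properties.CommutativeSemigroup
  (CommutativeMonoid.commutativeSemigroup ℚ.+-0-commutativeMonoid) using (interchange)
open import Function using (_∘_; Equivalence)
open import Relation.Nullary using (¬_; yes; no)
open import Relation.Nullary.Decidable using (⌊_⌋; toWitness; fromWitness; toWitnessFalse; fromWitnessFalse)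
open import Relation.Binary using (tri<; tri≈; tri>)
open import Relation.Binary.PropositionalEquality using (_≡_; _≢_; refl; cong; cong₂; sym; trans; subst)

+/1-homo-+ : ∀ m n → + (m + n) / 1 ≡ (+ m / 1) +ℚ (+ n / 1)
+/1-homo-+ m n
  rewrite ℚ.normalize-coprime (Coprime.sym (1-coprimeTo m)) | ℚ.normalize-coprime (Coprime.sym (1-coprimeTo n))
  = ℚ./-cong (trans (ℤ.pos-+ m n) (sym (cong₂ ℤ._+_ (ℤ.*-identityʳ (+ m)) (ℤ.*-identityʳ (+ n))))) refl

+/1-homo-* : ∀ m n → + (m * n) / 1 ≡ (+ m / 1) *ℚ (+ n / 1)
+/1-homo-* m n
  rewrite ℚ.normalize-coprime (Coprime.sym (1-coprimeTo m)) | ℚ.normalize-coprime (Coprime.sym (1-coprimeTo n))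
  = ℚ./-cong (ℤ.pos-* m n) refl

sumℚ-map-0 : ∀ {A : Set} (xs : List A) → sumℚ (map (λ _ → 0ℚ) xs) ≡ 0ℚ
sumℚ-map-0 []       = refl
sumℚ-map-0 (x ∷ xs) = trans (ℚ.+-identityˡ _) (sumℚ-map-0 xs)

sumℚ-map-+ : ∀ {A : Set} (f g : A → ℚ) (xs : List A) →
             sumℚ (map (λ a → f a +ℚ g a) xs) ≡ sumℚ (map f xs) +ℚ sumℚ (map g xs)
sumℚ-map-+ f g []       = sym (ℚ.+-identityˡ 0ℚ)
sumℚ-map-+ f g (x ∷ xs) =
  trans (cong (f x +ℚ g x +ℚ_) (sumℚ-map-+ f g xs)) (interchange (f x) (g x) _ _)

sumℚ-swap : ∀ {A B : Set} (F : A → B → ℚ) (xs : List A) (ys : List B) →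
            sumℚ (map (λ x → sumℚ (map (F x) ys)) xs) ≡ sumℚ (map (λ y → sumℚ (map (λ x → F x y) xs)) ys)
sumℚ-swap F []       ys = sym (sumℚ-map-0 ys)
sumℚ-swap F (x ∷ xs) ys = trans (cong (sumℚ (map (F x) ys) +ℚ_) (sumℚ-swap F xs ys))
                               (sym (sumℚ-map-+ (F x) (λ y → sumℚ (map (λ x′ → F x′ y) xs)) ys))

sumℚ-mono : ∀ {A : Set} {f g : A → ℚ} → (∀ a → f a ≤ℚ g a) → ∀ xs → sumℚ (map f xs) ≤ℚ sumℚ (map g xs)
sumℚ-mono f≤g []       = ℚ.≤-refl
sumℚ-mono f≤g (x ∷ xs) = ℚ.+-mono-≤ (f≤g x) (sumℚ-mono f≤g xs)

sumℚ-nonneg : ∀ {A : Set} {f : A → ℚ} → (∀ a → 0ℚ ≤ℚ f a) → ∀ xs → 0ℚ ≤ℚ sumℚ (map f xs)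
sumℚ-nonneg 0≤f xs = ℚ.≤-trans (ℚ.≤-reflexive (sym (sumℚ-map-0 xs))) (sumℚ-mono 0≤f xs)

∈⇒≤sumℚ : ∀ {A : Set} {f : A → ℚ} {x xs} → (∀ a → 0ℚ ≤ℚ f a) → x ∈ xs → f x ≤ℚ sumℚ (map f xs)
∈⇒≤sumℚ {f = f} {x} {_ ∷ xs} 0≤f (here refl) =
  ℚ.≤-trans (ℚ.≤-reflexive (sym (ℚ.+-identityʳ (f x)))) (ℚ.+-monoʳ-≤ (f x) (sumℚ-nonneg 0≤f xs))
∈⇒≤sumℚ {f = f} {x} {y ∷ xs} 0≤f (there x∈xs) =
  ℚ.≤-trans (ℚ.≤-reflexive (sym (ℚ.+-identityˡ (f x)))) (ℚ.+-mono-≤ (0≤f y) (∈⇒≤sumℚ 0≤f x∈xs))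

sumℚ-map-1 : ∀ {A : Set} (xs : List A) → sumℚ (map (λ _ → 1ℚ) xs) ≡ + length xs / 1
sumℚ-map-1 []       = refl
sumℚ-map-1 (x ∷ xs) = trans (cong (1ℚ +ℚ_) (sumℚ-map-1 xs)) (sym (+/1-homo-+ 1 (length xs)))

sumℚ-indicator-≡0 : ∀ {A : Set} (P : A → Bool) (c : ℚ) {xs : List A} → All (λ a → ¬ T (P a)) xs →
                    sumℚ (map (λ a → if P a then c else 0ℚ) xs) ≡ 0ℚ
sumℚ-indicator-≡0 P c []                          = refl
sumℚ-indicator-≡0 P c {a ∷ _} (¬Pa ∷ ¬P[xs]) with P a
... | true  = ⊥-elim (¬Pa tt)
... | false = trans (ℚ.+-identityˡ _) (sumℚ-indicator-≡0 P c ¬P[xs])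

sumℚ-indicator-≤ : ∀ {A : Set} (P : A → Bool) {c : ℚ} {xs : List A} → 0ℚ ≤ℚ c →
                   (∀ {a b} → T (P a) → T (P b) → a ≡ b) → Unique xs →
                   sumℚ (map (λ a → if P a then c else 0ℚ) xs) ≤ℚ c
sumℚ-indicator-≤ P 0≤c P-atMostOne []                      = 0≤c
sumℚ-indicator-≤ P {c} 0≤c P-atMostOne (_∷_ {a} a∉xs unique-xs) with P a in Pa≡true
... | true  = ℚ.≤-reflexive (trans (cong (c +ℚ_) (sumℚ-indicator-≡0 P c (All.map ¬P a∉xs))) (ℚ.+-identityʳ c))
  where
  ¬P : ∀ {b} → a ≢ b → ¬ T (P b)
  ¬P a≢b Pb = a≢b (P-atMostOne (subst T (sym Pa≡true) tt) Pb)
... | false = ℚ.≤-trans (ℚ.≤-reflexive (ℚ.+-identityˡ _)) (sumℚ-indicator-≤ P 0≤c P-atMostOne unique-xs)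

length-cartesianProduct : ∀ {A B : Set} (xs : List A) (ys : List B) →
                          length (cartesianProduct xs ys) ≡ length xs * length ys
length-cartesianProduct []       ys = refl
length-cartesianProduct (x ∷ xs) ys =
  trans (length-++ (map (x ,_) ys)) (cong₂ _+_ (length-map (x ,_) ys) (length-cartesianProduct xs ys))

length-vertices : ∀ s t → length (vertices s t) ≡ s * t
length-vertices s t =
  trans (length-cartesianProduct (allFin s) (allFin t))
        (cong₂ _*_ (length-tabulate {n = s} (λ i → i)) (length-tabulate {n = t} (λ j → j)))

∈-vertices : ∀ {s t} (v : Vertex s t) → v ∈ vertices s t
∈-vertices (i , j) = ∈-cartesianProduct⁺ (∈-allFin i) (∈-allFin j)

Close : ℕ → ℕ → Set
Close a b = a ≤ suc b × b ≤ suc a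

Close-≡ : ∀ {a b} → a ≡ b → Close a b
Close-≡ refl = ℕ.n≤1+n _ , ℕ.n≤1+n _

Close-suc : ∀ {a b} → suc a ≡ b → Close a b
Close-suc {a} refl = ℕ.m≤n+m a 2 , ℕ.≤-refl

Close-sym : ∀ {a b} → Close a b → Close b a
Close-sym (a≤ , b≤) = b≤ , a≤

Near : ∀ {s t} → Vertex s t → Vertex s t → Set
Near (i , j) (i′ , j′) = Close (toℕ i) (toℕ i′) × Close (toℕ j) (toℕ j′)

T-eqFin⇒≡ : ∀ {n} {i j : Fin n} → T (eqFin i j) → i ≡ j
T-eqFin⇒≡ {i = i} {j} = toWitness {a? = i ≟ᶠ j}

T-adjPath⇒Close : ∀ {n} (i j : Fin n) → T (adjPath i j) → Close (toℕ i) (toℕ j)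
T-adjPath⇒Close i j adj with Equivalence.to (T-∨ {⌊ suc (toℕ i) ℕ.≟ toℕ j ⌋} {⌊ suc (toℕ j) ℕ.≟ toℕ i ⌋}) adj
... | inj₁ i+1≡j = Close-suc (toWitness {a? = suc (toℕ i) ℕ.≟ toℕ j} i+1≡j)
... | inj₂ j+1≡i = Close-sym (Close-suc (toWitness {a? = suc (toℕ j) ℕ.≟ toℕ i} j+1≡i))

T-eqV⇒≡ : ∀ {s t} (p z : Vertex s t) → T (eqV p z) → p ≡ z
T-eqV⇒≡ (i , j) (i′ , j′) same with Equivalence.to T-∧ same
... | i≡i′ , j≡j′ = cong₂ _,_ (T-eqFin⇒≡ i≡i′) (T-eqFin⇒≡ j≡j′)

-- d₁ p z is definitionally capped (eqV p z) (adjGrid p z); stating facts about capped lets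
-- them case on the two tests, which `with` cannot reach inside d₁.
capped : Bool → Bool → ℕ
capped same adjacent = if same then 0 else if adjacent then 1 else 2

capped≡0⇒T : ∀ b₁ b₂ → capped b₁ b₂ ≡ 0 → T b₁
capped≡0⇒T true  _     _  = tt
capped≡0⇒T false true  ()
capped≡0⇒T false false ()

T⇒capped≡0 : ∀ b₁ b₂ → T b₁ → capped b₁ b₂ ≡ 0
T⇒capped≡0 true _ _ = refl

capped≢2⇒T⊎T : ∀ b₁ b₂ → capped b₁ b₂ ≢ 2 → T b₁ ⊎ T b₂
capped≢2⇒T⊎T true  _     _   = inj₁ tt
capped≢2⇒T⊎T false true  _   = inj₂ tt
capped≢2⇒T⊎T false false ≢2 = ⊥-elim (≢2 refl)

d₁-refl : ∀ {s t} (p : Vertex s t) → d₁ p p ≡ 0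
d₁-refl p@(i , j) = T⇒capped≡0 (eqV p p) (adjGrid p p)
  (Equivalence.from T-∧ (fromWitness {a? = i ≟ᶠ i} refl , fromWitness {a? = j ≟ᶠ j} refl))

d₁≡0⇒≡ : ∀ {s t} (p z : Vertex s t) → d₁ p z ≡ 0 → p ≡ z
d₁≡0⇒≡ p z d≡0 = T-eqV⇒≡ p z (capped≡0⇒T (eqV p z) (adjGrid p z) d≡0)

d₁≢2⇒Near : ∀ {s t} (p z : Vertex s t) → d₁ p z ≢ 2 → Near p z
d₁≢2⇒Near p@(i , j) z@(i′ , j′) d≢2 with capped≢2⇒T⊎T (eqV p z) (adjGrid p z) d≢2
... | inj₁ same = let p≡z = T-eqV⇒≡ p z same
                  in Close-≡ (cong (toℕ ∘ proj₁) p≡z) , Close-≡ (cong (toℕ ∘ proj₂) p≡z)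
... | inj₂ adj with Equivalence.to T-∨ adj
...   | inj₁ i≡i′∧j~j′ = let i≡i′ , j~j′ = Equivalence.to T-∧ i≡i′∧j~j′
                         in Close-≡ (cong toℕ (T-eqFin⇒≡ i≡i′)) , T-adjPath⇒Close j j′ j~j′
...   | inj₂ i~i′∧j≡j′ = let i~i′ , j≡j′ = Equivalence.to T-∧ i~i′∧j≡j′
                         in T-adjPath⇒Close i i′ i~i′ , Close-≡ (cong toℕ (T-eqFin⇒≡ j≡j′))

inR₁⇒Near⊎Near : ∀ {s t} (x y z : Vertex s t) → T (inR₁ x y z) → Near x z ⊎ Near y z
inR₁⇒Near⊎Near x y z z∈R with d₁ x z ℕ.≟ 2
... | no  dxz≢2 = inj₁ (d₁≢2⇒Near x z dxz≢2)
... | yes dxz≡2 = inj₂ (d₁≢2⇒Near y z λ dyz≡2 → toWitnessFalse z∈R (trans dxz≡2 (sym dyz≡2)))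

inR₁-self : ∀ {s t} (x y : Vertex s t) → x ≢ y → T (inR₁ x y x)
inR₁-self x y x≢y = fromWitnessFalse λ dxx≡dyx →
  x≢y (sym (d₁≡0⇒≡ y x (trans (sym dxx≡dyx) (d₁-refl x))))

InBlock : ℕ → ℕ → ℕ → Set
InBlock d q n = d * q ≤ n × n ℕ.< d * suc q

InBlock-unique : ∀ {d q q′ n} → InBlock d q n → InBlock d q′ n → q ≡ q′
InBlock-unique {d} {q} {q′} (lo , hi) (lo′ , hi′) with ℕ.<-cmp q q′
... | tri≈ _ q≡q′ _ = q≡q′
... | tri< q<q′ _ _ = ⊥-elim (ℕ.<-irrefl refl (ℕ.<-≤-trans hi (ℕ.≤-trans (ℕ.*-monoʳ-≤ d q<q′) lo′)))
... | tri> _ _ q′<q = ⊥-elim (ℕ.<-irrefl refl (ℕ.<-≤-trans hi′ (ℕ.≤-trans (ℕ.*-monoʳ-≤ d q′<q) lo)))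

Close-interior⇒InBlock : ∀ d q c {n} → 1 ≤ c → suc c ℕ.< d → Close (d * q + c) n → InBlock d q n
Close-interior⇒InBlock d q c {n} 1≤c 1+c<d (c≤ , ≤c) = ℕ.≤-pred lower , upper
  where
  open ℕ.≤-Reasoning
  lower : suc (d * q) ≤ suc n
  lower = begin
    suc (d * q)  ≡⟨ ℕ.+-comm 1 (d * q) ⟩
    d * q + 1    ≤⟨ ℕ.+-monoʳ-≤ (d * q) 1≤c ⟩
    d * q + c    ≤⟨ c≤ ⟩
    suc n        ∎
  upper : n ℕ.< d * suc q
  upper = begin-strict
    n                ≤⟨ ≤c ⟩
    suc (d * q + c)  ≡⟨ ℕ.+-suc (d * q) c ⟨
    d * q + suc c    <⟨ ℕ.+-monoʳ-< (d * q) 1+c<d ⟩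
    d * q + d        ≡⟨ ℕ.+-comm (d * q) d ⟩
    d + d * q        ≡⟨ ℕ.*-suc d q ⟨
    d * suc q        ∎

blockPos : ∀ {m} d → Fin m → Fin d → Fin (d * m)
blockPos {m} d k c = cast (ℕ.*-comm m d) (combine k c)

toℕ-blockPos : ∀ {m} d (k : Fin m) (c : Fin d) → toℕ (blockPos d k c) ≡ d * toℕ k + toℕ c
toℕ-blockPos d k c = trans (toℕ-cast _ (combine k c)) (toℕ-combine k c)

Close-blockPos⇒InBlock : ∀ {m} d (k : Fin m) (c : Fin d) {n} → 1 ≤ toℕ c → suc (toℕ c) ℕ.< d →
                     Close (toℕ (blockPos d k c)) n → InBlock d (toℕ k) n
Close-blockPos⇒InBlock d k c {n} 1≤c 1+c<d close =
  Close-interior⇒InBlock d (toℕ k) (toℕ c) 1≤c 1+c<d (subst (λ a → Close a n) (toℕ-blockPos d k c) close)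

-- Blocks are indexed by Vertex m m; block (k , l) is [4k, 4k+4) × [3l, 3l+3).
left right : ∀ {m} → Vertex m m → Vertex (4 * m) (3 * m)
left  (k , l) = blockPos 4 k 1F , blockPos 3 l 1F
right (k , l) = blockPos 4 k 2F , blockPos 3 l 1F

left≢right : ∀ {m} (b : Vertex m m) → left b ≢ right b
left≢right (k , l) left≡right with ℕ.+-cancelˡ-≡ (4 * toℕ k) 1 2
  (trans (sym (toℕ-blockPos 4 k 1F)) (trans (cong (toℕ ∘ proj₁) left≡right) (toℕ-blockPos 4 k 2F)))
... | ()

InGridBlock : ∀ {m} → Vertex m m → Vertex (4 * m) (3 * m) → Set
InGridBlock (k , l) (i , j) = InBlock 4 (toℕ k) (toℕ i) × InBlock 3 (toℕ l) (toℕ j)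

InGridBlock-unique : ∀ {m} (b b′ : Vertex m m) {z} → InGridBlock b z → InGridBlock b′ z → b ≡ b′
InGridBlock-unique (k , l) (k′ , l′) (i∈k , j∈l) (i∈k′ , j∈l′) =
  cong₂ _,_ (toℕ-injective (InBlock-unique {4} i∈k i∈k′)) (toℕ-injective (InBlock-unique {3} j∈l j∈l′))

R₁-left-right⊆InGridBlock : ∀ {m} (b : Vertex m m) z → T (inR₁ (left b) (right b) z) → InGridBlock b z
R₁-left-right⊆InGridBlock b@(k , l) z z∈R with inR₁⇒Near⊎Near (left b) (right b) z z∈R
... | inj₁ (i~ , j~) = Close-blockPos⇒InBlock 4 k 1F (s≤s z≤n) (s≤s (s≤s (s≤s z≤n))) i~
                     , Close-blockPos⇒InBlock 3 l 1F (s≤s z≤n) (s≤s (s≤s (s≤s z≤n))) j~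
... | inj₂ (i~ , j~) = Close-blockPos⇒InBlock 4 k 2F (s≤s z≤n) (s≤s (s≤s (s≤s (s≤s z≤n)))) i~
                     , Close-blockPos⇒InBlock 3 l 1F (s≤s z≤n) (s≤s (s≤s (s≤s z≤n))) j~

m*m≤total : ∀ m (h : Vertex (4 * m) (3 * m) → ℚ) → Is1TruncResolving h → + (m * m) / 1 ≤ℚ total h
m*m≤total m h (h∈[0,1] , resolves) = begin
  + (m * m) / 1                                   ≡⟨ cong (λ n → + n / 1) (length-vertices m m) ⟨
  + length B / 1                                  ≡⟨ sumℚ-map-1 B ⟨
  sumℚ (map (λ _ → 1ℚ) B)                         ≤⟨ sumℚ-mono 1≤weight B ⟩
  sumℚ (map (λ b → sumℚ (map (F b) V)) B)         ≡⟨ sumℚ-swap F B V ⟩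
  sumℚ (map (λ z → sumℚ (map (λ b → F b z) B)) V) ≤⟨ sumℚ-mono column≤h V ⟩
  total h                                         ∎
  where
  open ℚ.≤-Reasoning
  B : List (Vertex m m)
  B = vertices m m
  V : List (Vertex (4 * m) (3 * m))
  V = vertices (4 * m) (3 * m)
  F : Vertex m m → Vertex (4 * m) (3 * m) → ℚ
  F b z = if inR₁ (left b) (right b) z then h z else 0ℚ
  1≤weight : ∀ b → 1ℚ ≤ℚ weightR₁ h (left b) (right b)
  1≤weight b = resolves (left b) (right b) (left≢right b)
  column≤h : ∀ z → sumℚ (map (λ b → F b z) B) ≤ℚ h z
  column≤h z = sumℚ-indicator-≤ (λ b → inR₁ (left b) (right b) z) (proj₁ (h∈[0,1] z))
    (λ {b} {b′} z∈R z∈R′ →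
       InGridBlock-unique b b′ (R₁-left-right⊆InGridBlock b z z∈R) (R₁-left-right⊆InGridBlock b′ z z∈R′))
    (unique-cartesianProduct⁺ (allFin⁺ m) (allFin⁺ m))

if-T : ∀ {A : Set} {b} {p q : A} → T b → (if b then p else q) ≡ p
if-T {b = true} _ = refl

0≤1 : 0ℚ ≤ℚ 1ℚ
0≤1 = ℚ.nonNegative⁻¹ 1ℚ

if-nonneg : ∀ b {p} → 0ℚ ≤ℚ p → 0ℚ ≤ℚ (if b then p else 0ℚ)
if-nonneg true  0≤p = 0≤p
if-nonneg false _   = ℚ.≤-refl

const-1-resolving : ∀ {s t} → Is1TruncResolving {s} {t} (λ _ → 1ℚ)
const-1-resolving = (λ _ → 0≤1 , ℚ.≤-refl) , λ x y x≢y →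
  ℚ.≤-trans (ℚ.≤-reflexive (sym (if-T (inR₁-self x y x≢y))))
            (∈⇒≤sumℚ (λ z → if-nonneg (inR₁ x y z) 0≤1) (∈-vertices x))

total-const-1 : ∀ s t → total {s} {t} (λ _ → 1ℚ) ≡ + (s * t) / 1
total-const-1 s t = trans (sumℚ-map-1 (vertices s t)) (cong (λ n → + n / 1) (length-vertices s t))

4m*3m≡12*m*m : ∀ m → 4 * m * (3 * m) ≡ 12 * (m * m)
4m*3m≡12*m*m = solve 1 (λ m → (con 4 :* m) :* (con 3 :* m) := con 12 :* (m :* m)) refl
  where open +-*-Solver

proposition3p8 :
    Σ ℚ λ c₁ → Σ ℚ λ c₂ → (0ℚ < c₁) × (0ℚ < c₂) ×
      Σ ℕ λ M → ∀ (m : ℕ) → 1 ≤ m → M ≤ m →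
        ((∀ (h : Vertex (4 * m) (3 * m) → ℚ) → Is1TruncResolving h →
            c₁ *ℚ (+ (m * m) / 1) ≤ℚ total h)
        ×
        (Σ (Vertex (4 * m) (3 * m) → ℚ) λ h → Is1TruncResolving h ×
            (total h ≤ℚ c₂ *ℚ (+ (m * m) / 1))))
proposition3p8 = 1ℚ , + 12 / 1 , ℚ.positive⁻¹ 1ℚ , ℚ.positive⁻¹ (+ 12 / 1) , 0 , λ m _ _ →
  (λ h h-resolving → ℚ.≤-trans (ℚ.≤-reflexive (ℚ.*-identityˡ _)) (m*m≤total m h h-resolving)) ,
  (λ _ → 1ℚ) , const-1-resolving , ℚ.≤-reflexive (total-12m² m)
  where
  total-12m² : ∀ m → total {4 * m} {3 * m} (λ _ → 1ℚ) ≡ (+ 12 / 1) *ℚ (+ (m * m) / 1)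
  total-12m² m = trans (total-const-1 (4 * m) (3 * m))
                       (trans (cong (λ n → + n / 1) (4m*3m≡12*m*m m)) (+/1-homo-* 12 (m * m)))
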